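{- Let $\mathbf{m}=0110\,1001\dots$ be the Thue--Morse sequence over $\{0,1\}$, indexed from $0$. Then $$\{(a,b): a\ge0,\ b\ge1,\ \mathbf{m}_{a,b}\sim\mathbf{m}\}=\{(a,b): 0\le a<b=2^j \text{ for some } j\ge0\}.$$
   Context: $\mathbf{m}(n)$ is the parity of the number of $1$s in the binary expansion of $n$ (equivalently $\mathbf{m}(0)=0$, $\mathbf{m}(2n)=\mathbf{m}(n)$, $\mathbf{m}(2n+1)=1-\mathbf{m}(n)$). For a sequence $\sigma$ indexed from $0$, $\sigma_{a,b}(n)=\sigma(a+bn)$. For sequences $\sigma,\tau$ over $\mathbb{Z}/2\mathbb{Z}$, $\sigma\sim\tau$ means $\sigma=\tau+c$ (pointwise) for some constant $c\in\mathbb{Z}/2\mathbb{Z}$. -}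

module Defs where

open import Data.Nat using (ℕ; zero; suc; _+_; _*_; _%_; _/_)
open import Data.Bool using (Bool; false; true; not; _xor_; if_then_else_)
open import Relation.Binary.PropositionalEquality using (_≡_)
open import Data.Product using (Σ; ∃)

-- Thue–Morse over ℤ/2ℤ, represented as Bool (false = 0, true = 1).
-- tmFuel k n = parity of the number of 1s in the binary expansion of n,
-- computed with fuel k (k ≥ n suffices, since n / 2 < n for n ≥ 1).
tmFuel : ℕ → ℕ → Bool
tmFuel zero    n = false
tmFuel (suc k) zero = false
tmFuel (suc k) (suc n) =
  if (suc n % 2 Data.Nat.≡ᵇ 1) then not (tmFuel k (suc n / 2)) else tmFuel k (suc n / 2)

tm : ℕ → Bool
tm n = tmFuel n n

subseq : (ℕ → Bool) → ℕ → ℕ → (ℕ → Bool)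
subseq σ a b n = σ (a + b * n)

_∼_ : (ℕ → Bool) → (ℕ → Bool) → Set
σ ∼ τ = Σ Bool λ c → ∀ n → σ n ≡ τ n xor c

module Submission where

-- Everything rests on the recurrence tm n = tm ⌊n/2⌋ xor parity n, which we
-- extract from the fuelled definition in Defs, and on its consequence
-- tm (a + 2m) = tm (⌊a/2⌋ + m) xor parity a ("decimation").
--
-- (⇐) Iterating decimation j times gives tm (a + 2^j n) = tm a xor tm n
--     whenever a < 2^j.
-- (⇒) Call (a, b, c) a shifted copy if tm (a + b n) = tm n xor c for all n.
--     For even b, decimation turns a shifted copy with step b into one with
--     step b/2 and offset ⌊a/2⌋, so by induction on b it remains to rule out
--     odd b.  For that we study constant gaps: x < y and odd B with
--     tm (x + B n) xor tm (y + B n) constant in n.  Decimation halves both x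
--     and y, so the gap descends to y = x + 1, which is impossible because an
--     odd-step progression meets both even and odd numbers, and the adjacent
--     pairs (2j, 2j+1) and (2K+1, 2K+2) behave differently.  A shifted copy with
--     odd step b produces such a gap: from the even and odd terms of the
--     progression when b ≥ 3, and directly (x = 0, y = a) when b = 1.

open import Defs
open import Data.Nat using (ℕ; zero; suc; _+_; _*_; _%_; _/_; _^_; _<_; _≤_;
  z≤n; s≤s; s≤s⁻¹; ⌊_/2⌋; _≡ᵇ_)
open import Data.Nat.Properties
open import Data.Nat.DivMod using (m/n≡1+[m∸n]/n; m≤n⇒[n∸m]%m≡n%m)
open import Data.Nat.Induction using (<-wellFounded)
open import Data.Nat.Tactic.RingSolver using (solve-∀)
open import Data.Bool using (Bool; true; false; not; _xor_; if_then_else_)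
open import Data.Bool.Properties using (xor-∧-commutativeRing; xor-assoc;
  xor-comm; xor-same; xor-identityʳ; xor-inverseʳ; not-distribˡ-xor; not-involutive)
open import Algebra.Bundles using (CommutativeRing)
open import Algebra.Properties.CommutativeSemigroup
  (CommutativeRing.+-commutativeSemigroup xor-∧-commutativeRing)
  using (interchange; xy∙z≈xz∙y)
open import Data.Product using (Σ; _×_; _,_)
open import Data.Sum using (_⊎_; inj₁; inj₂)
open import Data.Empty using (⊥-elim)
open import Relation.Nullary using (¬_)
open import Induction.WellFounded using (Acc; acc)
open import Function.Bundles using (_⇔_; mk⇔)
open import Relation.Binary.PropositionalEquality
open ≡-Reasoning

parity : ℕ → Bool
parity zero          = false
parity (suc zero)    = true
parity (suc (suc n)) = parity n

div2≡half : ∀ n → n / 2 ≡ ⌊ n /2⌋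
div2≡half zero          = refl
div2≡half (suc zero)    = refl
div2≡half (suc (suc n)) =
  trans (m/n≡1+[m∸n]/n {suc (suc n)} {2} (s≤s (s≤s z≤n))) (cong suc (div2≡half n))

mod2≡parity : ∀ n → (n % 2 ≡ᵇ 1) ≡ parity n
mod2≡parity zero          = refl
mod2≡parity (suc zero)    = refl
mod2≡parity (suc (suc n)) =
  trans (cong (_≡ᵇ 1) (sym (m≤n⇒[n∸m]%m≡n%m {2} {suc (suc n)} (s≤s (s≤s z≤n)))))
        (mod2≡parity n)

half-decreases : ∀ {y} → 0 < y → ⌊ y /2⌋ < y
half-decreases {suc y} _ = ⌊n/2⌋<n y

+-double-suc : ∀ a m → a + 2 * suc m ≡ suc (suc (a + 2 * m))
+-double-suc = solve-∀

half-shift : ∀ a m → ⌊ a + 2 * m /2⌋ ≡ ⌊ a /2⌋ + m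
half-shift a zero    = trans (cong ⌊_/2⌋ (+-identityʳ a)) (sym (+-identityʳ ⌊ a /2⌋))
half-shift a (suc m) = begin
  ⌊ a + 2 * suc m /2⌋ ≡⟨ cong ⌊_/2⌋ (+-double-suc a m) ⟩
  suc ⌊ a + 2 * m /2⌋ ≡⟨ cong suc (half-shift a m) ⟩
  suc (⌊ a /2⌋ + m)   ≡⟨ sym (+-suc ⌊ a /2⌋ m) ⟩
  ⌊ a /2⌋ + suc m     ∎

parity-shift : ∀ a m → parity (a + 2 * m) ≡ parity a
parity-shift a zero    = cong parity (+-identityʳ a)
parity-shift a (suc m) = trans (cong parity (+-double-suc a m)) (parity-shift a m)

even-or-odd : ∀ n → Σ ℕ (λ h → n ≡ 2 * h) ⊎ Σ ℕ (λ h → n ≡ suc (2 * h))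
even-or-odd zero          = inj₁ (0 , refl)
even-or-odd (suc zero)    = inj₂ (0 , refl)
even-or-odd (suc (suc n)) with even-or-odd n
... | inj₁ (h , refl) = inj₁ (suc h , sym (+-double-suc 0 h))
... | inj₂ (h , refl) = inj₂ (suc h , cong suc (sym (+-double-suc 0 h)))

<-double⇒half< : ∀ {a h} → a < 2 * h → ⌊ a /2⌋ < h
<-double⇒half< {a} {h} a<2h =
  subst (suc ⌊ a /2⌋ ≤_) (half-shift 1 h) (⌊n/2⌋-mono (s≤s a<2h))

half<⇒<double : ∀ a {h} → ⌊ a /2⌋ < h → a < 2 * h
half<⇒<double a {h} q<h with even-or-odd a
... | inj₁ (q , refl) = *-monoʳ-< 2 (subst (_< h) (half-shift 0 q) q<h)
... | inj₂ (q , refl) = subst (_≤ 2 * h) (+-double-suc 0 q)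
                          (*-monoʳ-≤ 2 (subst (_< h) (half-shift 1 q) q<h))

half-gap : ∀ a {b} → 2 ≤ b → ⌊ a /2⌋ < ⌊ a + b /2⌋
half-gap a {b} 2≤b = ⌊n/2⌋-mono (subst (_≤ a + b) (+-comm a 2) (+-monoʳ-≤ a 2≤b))

xor-moveʳ : ∀ {x p s} → x xor p ≡ s → x ≡ s xor p
xor-moveʳ {x} {p} refl = sym (begin
  (x xor p) xor p ≡⟨ xor-assoc x p p ⟩
  x xor (p xor p) ≡⟨ cong (x xor_) (xor-same p) ⟩
  x xor false     ≡⟨ xor-identityʳ x ⟩
  x               ∎)

xor-of-shifted : ∀ x y p q {s t} → x xor p ≡ s → y xor q ≡ t →
                 x xor y ≡ (s xor t) xor (p xor q)
xor-of-shifted x y p q refl refl = xor-moveʳ (sym (interchange x p y q))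

if-not≡xor : ∀ p x → (if p then not x else x) ≡ x xor p
if-not≡xor false x = sym (xor-identityʳ x)
if-not≡xor true  x = sym (xor-comm x true)

tmFuel-at-zero : ∀ k → tmFuel k 0 ≡ false
tmFuel-at-zero zero    = refl
tmFuel-at-zero (suc k) = refl

half≤pred : ∀ n → suc n / 2 ≤ n
half≤pred n = subst (_≤ n) (sym (div2≡half (suc n))) (s≤s⁻¹ (⌊n/2⌋<n n))

tmFuel-agree : ∀ {k k′ n} → n ≤ k → n ≤ k′ → tmFuel k n ≡ tmFuel k′ n
tmFuel-agree {k} {k′} {zero} _ _ = trans (tmFuel-at-zero k) (sym (tmFuel-at-zero k′))
tmFuel-agree {suc k} {suc k′} {suc n} (s≤s n≤k) (s≤s n≤k′) =
  cong (λ x → if (suc n % 2 ≡ᵇ 1) then not x else x)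
       (tmFuel-agree (≤-trans (half≤pred n) n≤k) (≤-trans (half≤pred n) n≤k′))

tm-halving : ∀ n → tm n ≡ tm ⌊ n /2⌋ xor parity n
tm-halving zero    = refl
tm-halving (suc n) = begin
  tm (suc n)
    ≡⟨ cong₂ (λ p x → if p then not x else x)
             (mod2≡parity (suc n)) (tmFuel-agree (half≤pred n) ≤-refl) ⟩
  (if parity (suc n) then not (tm (suc n / 2)) else tm (suc n / 2))
    ≡⟨ if-not≡xor (parity (suc n)) (tm (suc n / 2)) ⟩
  tm (suc n / 2) xor parity (suc n)
    ≡⟨ cong (λ m → tm m xor parity (suc n)) (div2≡half (suc n)) ⟩
  tm ⌊ suc n /2⌋ xor parity (suc n) ∎

tm-split : ∀ a m → tm (a + 2 * m) ≡ tm (⌊ a /2⌋ + m) xor parity a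
tm-split a m = trans (tm-halving (a + 2 * m))
  (cong₂ (λ h p → tm h xor p) (half-shift a m) (parity-shift a m))

tm-decimate : ∀ a b n → tm (a + b * (2 * n)) ≡ tm (⌊ a /2⌋ + b * n) xor parity a
tm-decimate a b n = trans (cong (λ m → tm (a + m)) (double-inside b n)) (tm-split a (b * n))
  where
  double-inside : ∀ b n → b * (2 * n) ≡ 2 * (b * n)
  double-inside = solve-∀

tm-even : ∀ n → tm (2 * n) ≡ tm n
tm-even n = trans (tm-split 0 n) (xor-identityʳ (tm n))

tm-odd : ∀ n → tm (suc (2 * n)) ≡ not (tm n)
tm-odd n = trans (tm-split 1 n) (xor-comm (tm n) true)

tm-pair-even : ∀ j → tm (2 * j) xor tm (suc (2 * j)) ≡ true
tm-pair-even j = trans (cong₂ _xor_ (tm-even j) (tm-odd j)) (xor-inverseʳ (tm j))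

tm-pair-odd : ∀ K → tm K xor tm (suc K) ≡ not (tm (suc (2 * K)) xor tm (suc (suc (2 * K))))
tm-pair-odd K = sym (begin
  not (tm (suc (2 * K)) xor tm (suc (suc (2 * K))))
    ≡⟨ cong not (cong₂ _xor_ (tm-odd K)
                  (trans (cong tm (sym (+-double-suc 0 K))) (tm-even (suc K)))) ⟩
  not (not (tm K) xor tm (suc K)) ≡⟨ cong not (sym (not-distribˡ-xor (tm K) (tm (suc K)))) ⟩
  not (not (tm K xor tm (suc K))) ≡⟨ not-involutive _ ⟩
  tm K xor tm (suc K)             ∎)

tm-block : ∀ j {a} n → a < 2 ^ j → tm (a + 2 ^ j * n) ≡ tm a xor tm n
tm-block zero    {zero}  n _ = cong tm (*-identityˡ n)
tm-block zero    {suc a} n (s≤s ())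
tm-block (suc j) {a}     n a<2^j+1 = begin
  tm (a + 2 * 2 ^ j * n)              ≡⟨ cong (λ m → tm (a + m)) (*-assoc 2 (2 ^ j) n) ⟩
  tm (a + 2 * (2 ^ j * n))            ≡⟨ tm-split a (2 ^ j * n) ⟩
  tm (⌊ a /2⌋ + 2 ^ j * n) xor parity a
    ≡⟨ cong (_xor parity a) (tm-block j n (<-double⇒half< a<2^j+1)) ⟩
  (tm ⌊ a /2⌋ xor tm n) xor parity a  ≡⟨ xy∙z≈xz∙y (tm ⌊ a /2⌋) (tm n) (parity a) ⟩
  (tm ⌊ a /2⌋ xor parity a) xor tm n  ≡⟨ cong (_xor tm n) (sym (tm-halving a)) ⟩
  tm a xor tm n                        ∎

ShiftedCopy : ℕ → ℕ → Bool → Set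
ShiftedCopy a b c = ∀ n → tm (a + b * n) ≡ tm n xor c

ConstantGap : ℕ → ℕ → ℕ → Bool → Set
ConstantGap x y B e = ∀ n → tm (x + B * n) xor tm (y + B * n) ≡ e

copy-halve : ∀ {a b c} → ShiftedCopy a (2 * b) c → ShiftedCopy ⌊ a /2⌋ b (c xor parity a)
copy-halve {a} {b} {c} copy n = begin
  tm (⌊ a /2⌋ + b * n)              ≡⟨ xor-moveʳ (sym (tm-split a (b * n))) ⟩
  tm (a + 2 * (b * n)) xor parity a ≡⟨ cong (λ m → tm (a + m) xor parity a) (sym (*-assoc 2 b n)) ⟩
  tm (a + 2 * b * n) xor parity a   ≡⟨ cong (_xor parity a) (copy n) ⟩
  (tm n xor c) xor parity a         ≡⟨ xor-assoc (tm n) c (parity a) ⟩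
  tm n xor (c xor parity a)         ∎

-- the even and odd terms of a shifted copy are complementary, giving a gap
copy-gap : ∀ {a b c} → ShiftedCopy a b c →
           ConstantGap ⌊ a /2⌋ ⌊ a + b /2⌋ b (not (parity a xor parity (a + b)))
copy-gap {a} {b} {c} copy n =
  trans (xor-of-shifted (tm (⌊ a /2⌋ + b * n)) (tm (⌊ a + b /2⌋ + b * n))
                        (parity a) (parity (a + b)) even-terms odd-terms)
        (cong (_xor (parity a xor parity (a + b))) complementary)
  where
  odd-index : ∀ a b n → a + b * suc (2 * n) ≡ a + b + b * (2 * n)
  odd-index = solve-∀
  even-terms : tm (⌊ a /2⌋ + b * n) xor parity a ≡ tm n xor c
  even-terms = begin
    tm (⌊ a /2⌋ + b * n) xor parity a ≡⟨ sym (tm-decimate a b n) ⟩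
    tm (a + b * (2 * n))              ≡⟨ copy (2 * n) ⟩
    tm (2 * n) xor c                  ≡⟨ cong (_xor c) (tm-even n) ⟩
    tm n xor c                        ∎
  odd-terms : tm (⌊ a + b /2⌋ + b * n) xor parity (a + b) ≡ not (tm n) xor c
  odd-terms = begin
    tm (⌊ a + b /2⌋ + b * n) xor parity (a + b) ≡⟨ sym (tm-decimate (a + b) b n) ⟩
    tm (a + b + b * (2 * n))                    ≡⟨ cong tm (sym (odd-index a b n)) ⟩
    tm (a + b * suc (2 * n))                    ≡⟨ copy (suc (2 * n)) ⟩
    tm (suc (2 * n)) xor c                      ≡⟨ cong (_xor c) (tm-odd n) ⟩
    not (tm n) xor c                            ∎
  complementary : (tm n xor c) xor (not (tm n) xor c) ≡ true
  complementary = trans (cong ((tm n xor c) xor_) (sym (not-distribˡ-xor (tm n) c)))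
                        (xor-inverseʳ (tm n xor c))

copy-unit-gap : ∀ {a c} → ShiftedCopy a 1 c → ConstantGap 0 a 1 c
copy-unit-gap {a} {c} copy n = begin
  tm (1 * n) xor tm (a + 1 * n) ≡⟨ cong₂ _xor_ (cong tm (*-identityˡ n)) (copy n) ⟩
  tm n xor (tm n xor c)         ≡⟨ sym (xor-assoc (tm n) (tm n) c) ⟩
  (tm n xor tm n) xor c         ≡⟨ cong (_xor c) (xor-same (tm n)) ⟩
  c                             ∎

gap-halve : ∀ {x y B e} → ConstantGap x y B e →
            ConstantGap ⌊ x /2⌋ ⌊ y /2⌋ B (e xor (parity x xor parity y))
gap-halve {x} {y} {B} gap n =
  trans (xor-of-shifted (tm (⌊ x /2⌋ + B * n)) (tm (⌊ y /2⌋ + B * n)) (parity x) (parity y)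
                        (sym (tm-decimate x B n)) (sym (tm-decimate y B n)))
        (cong (_xor (parity x xor parity y)) (gap (2 * n)))

bit : Bool → ℕ
bit false = 0
bit true  = 1

-- the arithmetic behind odd-progression: stepping by an even multiple of the
-- odd step keeps the parity, stepping by an odd multiple flips it
step-even : ∀ d h k m → d + 2 * h + suc (2 * k) * (2 * m) ≡ d + 2 * (h + suc (2 * k) * m)
step-even = solve-∀

step-odd-from-even : ∀ h k m →
  2 * h + suc (2 * k) * suc (2 * m) ≡ suc (2 * (h + k + suc (2 * k) * m))
step-odd-from-even = solve-∀

step-odd-from-odd : ∀ h k m →
  suc (2 * h) + suc (2 * k) * suc (2 * m) ≡ 2 * (suc (h + k) + suc (2 * k) * m)
step-odd-from-odd = solve-∀

-- a progression with odd step 2k+1 meets each residue r modulo 2 along a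
-- sub-progression whose halves again have step 2k+1
odd-progression : ∀ k z r → Σ ℕ λ w → ∀ m → Σ ℕ λ n →
                  z + suc (2 * k) * n ≡ bit r + 2 * (w + suc (2 * k) * m)
odd-progression k z r with even-or-odd z | r
... | inj₁ (h , refl) | false = h ,          λ m → 2 * m ,       step-even 0 h k m
... | inj₂ (h , refl) | true  = h ,          λ m → 2 * m ,       step-even 1 h k m
... | inj₁ (h , refl) | true  = h + k ,      λ m → suc (2 * m) , step-odd-from-even h k m
... | inj₂ (h , refl) | false = suc (h + k), λ m → suc (2 * m) , step-odd-from-odd h k m

-- a unit gap with odd step must be true: it contains a pair (2j, 2j+1)
unit-gap-is-true : ∀ k {z e} → ConstantGap z (suc z) (suc (2 * k)) e → e ≡ true
unit-gap-is-true k {z} {e} gap with odd-progression k z false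
... | w , hit with hit 0
... | n , z+Bn≡2j = begin
  e                                                   ≡⟨ sym (gap n) ⟩
  tm (z + suc (2 * k) * n) xor tm (suc (z + suc (2 * k) * n))
    ≡⟨ cong (λ u → tm u xor tm (suc u)) z+Bn≡2j ⟩
  tm (2 * j) xor tm (suc (2 * j))                     ≡⟨ tm-pair-even j ⟩
  true                                                ∎
  where j = w + suc (2 * k) * 0

-- restricted to the pairs (2K+1, 2K+2), a true unit gap yields a false one
unit-gap-descends : ∀ k {z} → ConstantGap z (suc z) (suc (2 * k)) true →
                    Σ ℕ λ w → ConstantGap w (suc w) (suc (2 * k)) false
unit-gap-descends k {z} gap with odd-progression k z true
... | w , hit = w , λ m → let (n , z+Bn≡2K+1) = hit m ; K = w + suc (2 * k) * m in begin
  tm K xor tm (suc K)                                     ≡⟨ tm-pair-odd K ⟩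
  not (tm (suc (2 * K)) xor tm (suc (suc (2 * K))))
    ≡⟨ cong (λ u → not (tm u xor tm (suc u))) (sym z+Bn≡2K+1) ⟩
  not (tm (z + suc (2 * k) * n) xor tm (suc (z + suc (2 * k) * n)))
    ≡⟨ cong not (gap n) ⟩
  false                                                   ∎

no-unit-gap : ∀ k {z e} → ¬ ConstantGap z (suc z) (suc (2 * k)) e
no-unit-gap k {z} gap with unit-gap-is-true k {z} gap
... | refl with unit-gap-descends k {z} gap
...   | w , false-gap with unit-gap-is-true k {w} false-gap
...     | ()

-- halving shrinks every gap of width at least 2 until it has width 1
no-gap : ∀ k {x y e} → x < y → ¬ ConstantGap x y (suc (2 * k)) e
no-gap k {y = y} = descend (<-wellFounded y)
  where
  descend : ∀ {x y e} → Acc _<_ y → x < y → ¬ ConstantGap x y (suc (2 * k)) e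
  descend {x} {y} (acc smaller) x<y gap with m≤n⇒m<n∨m≡n x<y
  ... | inj₂ refl  = no-unit-gap k {x} gap
  ... | inj₁ x+1<y = descend (smaller (half-decreases (≤-trans (s≤s z≤n) x<y)))
                             (⌊n/2⌋-mono x+1<y) (gap-halve {x} {y} {suc (2 * k)} gap)

copy-step-one : ∀ {a c} → ShiftedCopy a 1 c → a < 1
copy-step-one {zero}        _    = s≤s z≤n
copy-step-one {suc a} {c} copy =
  ⊥-elim (no-gap 0 {0} {suc a} {c} (s≤s z≤n) (copy-unit-gap {suc a} copy))

-- by induction on the step: halve even steps, refute odd steps b ≥ 3
copy-forces-power : ∀ {b} → Acc _<_ b → 1 ≤ b → ∀ {a c} → ShiftedCopy a b c →
                    a < b × Σ ℕ (λ j → b ≡ 2 ^ j)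
copy-forces-power {b} (acc smaller) 1≤b {a} {c} copy with even-or-odd b
... | inj₁ (zero , refl) with () ← 1≤b
... | inj₁ (suc h , refl) =
  let (⌊a/2⌋<h , j , h≡2^j) = copy-forces-power (smaller (m<m+n (suc h) (s≤s z≤n)))
                                (s≤s z≤n) (copy-halve {a} {suc h} {c} copy)
  in half<⇒<double a ⌊a/2⌋<h , suc j , cong (2 *_) h≡2^j
... | inj₂ (zero , refl)  = copy-step-one copy , 0 , refl
... | inj₂ (suc h , refl) =
  ⊥-elim (no-gap (suc h) (half-gap a (s≤s (s≤s z≤n))) (copy-gap {a} {b} {c} copy))

mainTheorem6 : (a b : ℕ) → 1 ≤ b →
    (subseq tm a b ∼ tm) ⇔ (a < b × Σ ℕ (λ j → b ≡ 2 ^ j))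
mainTheorem6 a b 1≤b = mk⇔ necessary sufficient
  where
  necessary : subseq tm a b ∼ tm → a < b × Σ ℕ (λ j → b ≡ 2 ^ j)
  necessary (c , copy) = copy-forces-power (<-wellFounded b) 1≤b {a} copy

  sufficient : a < b × Σ ℕ (λ j → b ≡ 2 ^ j) → subseq tm a b ∼ tm
  sufficient (a<b , j , b≡2^j) = tm a , λ n → begin
    tm (a + b * n)       ≡⟨ cong (λ B → tm (a + B * n)) b≡2^j ⟩
    tm (a + 2 ^ j * n)   ≡⟨ tm-block j n (subst (a <_) b≡2^j a<b) ⟩
    tm a xor tm n        ≡⟨ xor-comm (tm a) (tm n) ⟩
    tm n xor tm a        ∎
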